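{- For every integer $n \ge 1$, let $f(n)$ be the maximum, over all cyclic permutations $\pi$ of order $n$, of the minimum number of adjacent swaps needed to transform $\pi$ into the trivial cyclic permutation $u=(1,2,\ldots,n)$. Then \[ f(n) \le \left\lfloor \frac{(n-1)^2}{4} \right\rfloor. \]
   Context: A cyclic permutation of order $n$ is a bijective labeling of the vertices of a cycle of length $n$ by the elements of $[n]=\{1,\ldots,n\}$, where two labelings that differ by a rotation of the cycle (a cyclic shift) are considered the same; reflections are not identified. An adjacent swap transforms a cyclic permutation into the one obtained by exchanging the labels of two vertices that are adjacent along the cycle. The trivial cyclic permutation $u=(1,2,\ldots,n)$ is the labeling in which the labels $1,2,\ldots,n$ appear consecutively around the cycle in this order. -}

module Defs where

open import Data.Nat using (ℕ; zero; suc; _+_; NonZero)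
open import Data.Nat.DivMod using (_mod_)
open import Data.Fin using (Fin; toℕ)
open import Data.Product using (∃)
open import Relation.Binary.PropositionalEquality using (_≡_)
open import Data.Fin.Permutation.Components using (transpose)

-- A labeling of the cycle of length n: vertex (position) j ∈ Fin n, read
-- cyclically (position n-1 is adjacent to position 0), carries label σ j.
-- Labels 0..n-1 stand for 1..n. A cyclic permutation is such a bijective
-- labeling up to rotation; we work with representatives.
Labeling : ℕ → Set
Labeling n = Fin n → Fin n

next : ∀ {n} .{{_ : NonZero n}} → Fin n → Fin n
next {n} i = (suc (toℕ i)) mod n

rotate : ∀ {n} .{{_ : NonZero n}} → ℕ → Labeling n → Labeling n
rotate {n} k σ j = σ ((toℕ j + k) mod n)

trivial : ∀ {n} → Labeling n
trivial j = j

IsTrivialCyclic : ∀ {n} .{{_ : NonZero n}} → Labeling n → Set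
IsTrivialCyclic {n} σ = ∃ λ k → ∀ j → σ j ≡ rotate k trivial j

swapAdj : ∀ {n} .{{_ : NonZero n}} → Fin n → Labeling n → Labeling n
swapAdj i σ j = σ (transpose i (next i) j)

data SwapPath {n : ℕ} .{{_ : NonZero n}} : ℕ → Labeling n → Labeling n → Set where
  done : ∀ {π} → SwapPath zero π π
  step : ∀ {m π σ} (i : Fin n) → SwapPath m (swapAdj i π) σ → SwapPath (suc m) π σ

{-# OPTIONS --safe #-}
module Submission where

open import Defs
open import Level using (0ℓ)
open import Data.Nat
open import Data.Nat.Properties
open import Data.Nat.DivMod
open import Data.Nat.ListAction using (sum)
open import Data.Nat.ListAction.Properties using (sum-↭; sum-++)
open import Data.Nat.Solver using (module +-*-Solver)
open +-*-Solver using (solve; _:=_; _:+_; _:*_; con)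
open import Data.List using (List; []; _∷_; _++_; [_]; length; map; applyUpTo)
open import Data.List.Properties using (length-++; map-++; length-applyUpTo)
open import Data.List.Relation.Binary.Permutation.Propositional using (_↭_; ↭-refl; ↭-prep; ↭-swap)
open import Data.List.Relation.Binary.Permutation.Propositional.Properties using (map⁺; ↭-length)
open import Data.Fin as Fin using (Fin; toℕ)
open import Data.Fin.Properties using (toℕ-injective; toℕ-fromℕ<; toℕ<n)
open import Data.Fin.Permutation using (permutation)
open import Data.Fin.Permutation.Components using (transpose; transpose-inverse)
open import Data.Product using (∃; ∃₂; _×_; _,_; proj₁; proj₂)
open import Data.Sum using (_⊎_; inj₁; inj₂)
open import Function using (id; _∘_; flip)
open import Function.Definitions using (Injective; Bijective)
import Function.Construct.Identity as Identity
open import Relation.Nullary using (yes; no; contradiction)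
open import Relation.Binary.Bundles using (Setoid)
open import Relation.Binary.Definitions using (tri<; tri≈; tri>)
import Relation.Binary.Construct.On as On
import Relation.Binary.Reasoning.Setoid as SetoidReasoning
open import Relation.Binary.PropositionalEquality hiding ([_])
open import Algebra.Properties.CommutativeSemigroup +-commutativeSemigroup
  using () renaming (interchange to +-interchange)
import Algebra.Properties.CommutativeMonoid.Sum +-0-commutativeMonoid as FinSum

-- Read the cycle from some position and give every position a natural number whose residue mod n is
-- its label; call such a list a lift. The cost of a lift adds up, over all pairs of positions, the
-- number of inversions per period between the n-periodic extensions of their values. Swapping an
-- adjacent descent lowers the cost by one, moving the first value to the end raised by n (reading
-- from the next position) keeps it, and a lift without descents that fits in a window of length n
-- is a rotation of the identity. So a lift of cost c is sorted by at most c adjacent swaps.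
-- For the n lifts that put the value of position i into [n - k + i, 2n - k + i), the pair i < j
-- contributes exactly |D - (j - i)| in total, where D = (π j - π i) mod n. Since
-- 2|D - g| ≤ |2D - n| + |2g - n|, D_ij + D_ji = n and every row of D runs through all residues, the
-- total cost is at most n(n - 1)²/4, and some lift costs at most (n - 1)²/4.

∑ : ℕ → (ℕ → ℕ) → ℕ
∑ n f = sum (applyUpTo f n)

∑-cong : ∀ n {f g : ℕ → ℕ} → (∀ i → i < n → f i ≡ g i) → ∑ n f ≡ ∑ n g
∑-cong zero    f≡g = refl
∑-cong (suc n) f≡g = cong₂ _+_ (f≡g 0 z<s) (∑-cong n (λ i i<n → f≡g (suc i) (s<s i<n)))

∑-mono-≤ : ∀ n {f g : ℕ → ℕ} → (∀ i → i < n → f i ≤ g i) → ∑ n f ≤ ∑ n g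
∑-mono-≤ zero    f≤g = z≤n
∑-mono-≤ (suc n) f≤g = +-mono-≤ (f≤g 0 z<s) (∑-mono-≤ n (λ i i<n → f≤g (suc i) (s<s i<n)))

∑-const : ∀ n c → ∑ n (λ _ → c) ≡ n * c
∑-const zero    c = refl
∑-const (suc n) c = cong (c +_) (∑-const n c)

∑-zero : ∀ n → ∑ n (λ _ → 0) ≡ 0
∑-zero n = trans (∑-const n 0) (*-zeroʳ n)

∑-distrib-+ : ∀ n (f g : ℕ → ℕ) → ∑ n (λ i → f i + g i) ≡ ∑ n f + ∑ n g
∑-distrib-+ zero    f g = refl
∑-distrib-+ (suc n) f g = trans (cong (f 0 + g 0 +_) (∑-distrib-+ n (f ∘ suc) (g ∘ suc)))
                                (+-interchange (f 0) (g 0) _ _)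

*-distribˡ-∑ : ∀ n c (f : ℕ → ℕ) → c * ∑ n f ≡ ∑ n (λ i → c * f i)
*-distribˡ-∑ zero    c f = *-zeroʳ c
*-distribˡ-∑ (suc n) c f = trans (*-distribˡ-+ c (f 0) _) (cong (c * f 0 +_) (*-distribˡ-∑ n c (f ∘ suc)))

∑-comm : ∀ m n (f : ℕ → ℕ → ℕ) → ∑ m (λ i → ∑ n (f i)) ≡ ∑ n (λ j → ∑ m (λ i → f i j))
∑-comm zero    n f = sym (∑-zero n)
∑-comm (suc m) n f = trans (cong (∑ n (f 0) +_) (∑-comm m n (f ∘ suc)))
                           (sym (∑-distrib-+ n (f 0) (λ j → ∑ m (λ i → f (suc i) j))))

∑-split : ∀ m k (f : ℕ → ℕ) → ∑ (m + k) f ≡ ∑ m f + ∑ k (λ i → f (m + i))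
∑-split zero    k f = refl
∑-split (suc m) k f = trans (cong (f 0 +_) (∑-split m k (f ∘ suc))) (sym (+-assoc (f 0) _ _))

∑-last : ∀ n (f : ℕ → ℕ) → ∑ (suc n) f ≡ ∑ n f + f n
∑-last n f = begin
  ∑ (suc n) f                       ≡⟨ cong (λ m → ∑ m f) (+-comm 1 n) ⟩
  ∑ (n + 1) f                       ≡⟨ ∑-split n 1 f ⟩
  ∑ n f + (f (n + 0) + 0)           ≡⟨ cong (λ x → ∑ n f + x) (trans (+-identityʳ _) (cong f (+-identityʳ n))) ⟩
  ∑ n f + f n                       ∎
  where open ≡-Reasoning

∑pairs : ℕ → (ℕ → ℕ → ℕ) → ℕ
∑pairs zero    Q = 0
∑pairs (suc n) Q = ∑ n (Q 0 ∘ suc) + ∑pairs n (λ i j → Q (suc i) (suc j))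

∑pairs-cong : ∀ n {Q R : ℕ → ℕ → ℕ} → (∀ i j → i < j → j < n → Q i j ≡ R i j) → ∑pairs n Q ≡ ∑pairs n R
∑pairs-cong zero    Q≡R = refl
∑pairs-cong (suc n) Q≡R = cong₂ _+_ (∑-cong n (λ j j<n → Q≡R 0 (suc j) z<s (s<s j<n)))
                                    (∑pairs-cong n (λ i j i<j j<n → Q≡R (suc i) (suc j) (s<s i<j) (s<s j<n)))

∑pairs-mono-≤ : ∀ n {Q R : ℕ → ℕ → ℕ} → (∀ i j → i < j → j < n → Q i j ≤ R i j) → ∑pairs n Q ≤ ∑pairs n R
∑pairs-mono-≤ zero    Q≤R = z≤n
∑pairs-mono-≤ (suc n) Q≤R = +-mono-≤ (∑-mono-≤ n (λ j j<n → Q≤R 0 (suc j) z<s (s<s j<n)))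
                                     (∑pairs-mono-≤ n (λ i j i<j j<n → Q≤R (suc i) (suc j) (s<s i<j) (s<s j<n)))

∑pairs-distrib-+ : ∀ n (Q R : ℕ → ℕ → ℕ) → ∑pairs n (λ i j → Q i j + R i j) ≡ ∑pairs n Q + ∑pairs n R
∑pairs-distrib-+ zero    Q R = refl
∑pairs-distrib-+ (suc n) Q R =
  trans (cong₂ _+_ (∑-distrib-+ n (Q 0 ∘ suc) (R 0 ∘ suc)) (∑pairs-distrib-+ n _ _))
        (+-interchange (∑ n (Q 0 ∘ suc)) (∑ n (R 0 ∘ suc)) _ _)

*-distribˡ-∑pairs : ∀ n c (Q : ℕ → ℕ → ℕ) → c * ∑pairs n Q ≡ ∑pairs n (λ i j → c * Q i j)
*-distribˡ-∑pairs zero    c Q = *-zeroʳ c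
*-distribˡ-∑pairs (suc n) c Q = trans (*-distribˡ-+ c _ _)
  (cong₂ _+_ (*-distribˡ-∑ n c (Q 0 ∘ suc)) (*-distribˡ-∑pairs n c (λ i j → Q (suc i) (suc j))))

∑-∑pairs-comm : ∀ m n (Q : ℕ → ℕ → ℕ → ℕ) →
                ∑ m (λ k → ∑pairs n (Q k)) ≡ ∑pairs n (λ i j → ∑ m (λ k → Q k i j))
∑-∑pairs-comm m zero    Q = ∑-zero m
∑-∑pairs-comm m (suc n) Q = trans (∑-distrib-+ m _ _)
  (cong₂ _+_ (∑-comm m n (λ k j → Q k 0 (suc j))) (∑-∑pairs-comm m n (λ k i j → Q k (suc i) (suc j))))

∑pairs-symmetric : ∀ n (Q : ℕ → ℕ → ℕ) → (∀ i j → i < j → j < n → Q i j ≡ Q j i) →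
                   2 * ∑pairs n Q + ∑ n (λ i → Q i i) ≡ ∑ n (λ i → ∑ n (Q i))
∑pairs-symmetric zero    Q sym-Q = refl
∑pairs-symmetric (suc n) Q sym-Q = begin
  2 * (row + rest) + (Q 0 0 + diag)
    ≡⟨ solve 4 (λ r p q d → con 2 :* (r :+ p) :+ (q :+ d) := q :+ r :+ (r :+ (con 2 :* p :+ d))) refl row rest (Q 0 0) diag ⟩
  Q 0 0 + row + (row + (2 * rest + diag))
    ≡⟨ cong₂ (λ a b → Q 0 0 + row + (a + b)) (∑-cong n (λ j j<n → sym-Q 0 (suc j) z<s (s<s j<n)))
             (∑pairs-symmetric n _ (λ i j i<j j<n → sym-Q (suc i) (suc j) (s<s i<j) (s<s j<n))) ⟩
  Q 0 0 + row + (∑ n (λ i → Q (suc i) 0) + ∑ n (λ i → ∑ n (Q (suc i) ∘ suc)))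
    ≡⟨ cong (Q 0 0 + row +_) (sym (∑-distrib-+ n _ _)) ⟩
  ∑ (suc n) (λ i → ∑ (suc n) (Q i)) ∎
  where
  open ≡-Reasoning
  row = ∑ n (Q 0 ∘ suc)
  rest = ∑pairs n (λ i j → Q (suc i) (suc j))
  diag = ∑ n (λ i → Q (suc i) (suc i))

∃-≤-average : ∀ n .{{_ : NonZero n}} (f : ℕ → ℕ) X → ∑ n f ≤ n * X → ∃ λ k → k < n × f k ≤ X
∃-≤-average (suc n) = go n
  where
  go : ∀ n (f : ℕ → ℕ) X → ∑ (suc n) f ≤ suc n * X → ∃ λ k → k < suc n × f k ≤ X
  go zero    f X ∑≤ = 0 , z<s , subst₂ _≤_ (+-identityʳ (f 0)) (+-identityʳ X) ∑≤
  go (suc n) f X ∑≤ with f 0 ≤? X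
  ... | yes f0≤X = 0 , z<s , f0≤X
  ... | no  f0≰X
    with k , k<n , fk≤X ← go n (f ∘ suc) X (<⇒≤ (+-cancelˡ-< X _ _ (<-≤-trans (+-monoˡ-< _ (≰⇒> f0≰X)) ∑≤)))
    = suc k , s<s k<n , fk≤X

[m+n]/n≡1+m/n : ∀ m n .{{_ : NonZero n}} → (m + n) / n ≡ suc (m / n)
[m+n]/n≡1+m/n m n = trans (m/n≡1+[m∸n]/n (m≤n+m n m)) (cong (λ x → suc (x / n)) (m+n∸n≡m m n))

∣a-b∣≡∣d-c∣ : ∀ a b {c d} → a + c ≡ b + d → ∣ a - b ∣ ≡ ∣ d - c ∣
∣a-b∣≡∣d-c∣ a b {c} {d} a+c≡b+d = begin
  ∣ a - b ∣              ≡⟨ ∣m+n-m+o∣≡∣n-o∣ c a b ⟨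
  ∣ c + a - c + b ∣      ≡⟨ cong₂ ∣_-_∣ (trans (+-comm c a) a+c≡b+d) (+-comm c b) ⟩
  ∣ b + d - b + c ∣      ≡⟨ ∣m+n-m+o∣≡∣n-o∣ b d c ⟩
  ∣ d - c ∣              ∎
  where open ≡-Reasoning

n≤m<n+n⇒m/n≡1 : ∀ {m n} .{{_ : NonZero n}} → n ≤ m → m < n + n → m / n ≡ 1
n≤m<n+n⇒m/n≡1 {m} {n} n≤m m<n+n =
  trans (m/n≡1+[m∸n]/n n≤m) (cong suc (m<n⇒m/n≡0 (subst (m ∸ n <_) (m+n∸n≡m n n) (∸-monoˡ-< m<n+n n≤m))))

n≤m<n+n⇒m%n+n≡m : ∀ {m n} .{{_ : NonZero n}} → n ≤ m → m < n + n → m % n + n ≡ m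
n≤m<n+n⇒m%n+n≡m {m} {n} n≤m m<n+n = begin
  m % n + n          ≡⟨ cong (m % n +_) (trans (cong (_* n) (n≤m<n+n⇒m/n≡1 n≤m m<n+n)) (*-identityˡ n)) ⟨
  m % n + m / n * n  ≡⟨ m≡m%n+[m/n]*n m n ⟨
  m                  ∎
  where open ≡-Reasoning

∑-∣2d-n∣-≤ : ∀ n → 2 * ∑ n (λ d → ∣ 2 * d - n ∣) ≤ n * n + 1
∑-∣2d-n∣-≤ zero          = z≤n
∑-∣2d-n∣-≤ (suc zero)    = s≤s (s≤s z≤n)
∑-∣2d-n∣-≤ (suc (suc n)) = begin
  2 * ∑ (2 + n) (λ d → ∣ 2 * d - (2 + n) ∣)
    ≡⟨ cong (λ x → 2 * (2 + n + x)) (∑-cong (suc n) (λ d _ → cong (λ x → ∣ x - 2 + n ∣) (*-suc 2 d))) ⟩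
  2 * (2 + n + ∑ (suc n) (λ d → ∣ 2 * d - n ∣))
    ≡⟨ cong (λ x → 2 * (2 + n + x)) (∑-last n _) ⟩
  2 * (2 + n + (B + ∣ 2 * n - n ∣))
    ≡⟨ cong (λ x → 2 * (2 + n + (B + x))) ∣2n-n∣≡n ⟩
  2 * (2 + n + (B + n))
    ≡⟨ solve 2 (λ b m → con 2 :* (con 2 :+ m :+ (b :+ m)) := con 2 :* b :+ (con 4 :+ con 4 :* m)) refl B n ⟩
  2 * B + (4 + 4 * n)
    ≤⟨ +-monoˡ-≤ (4 + 4 * n) (∑-∣2d-n∣-≤ n) ⟩
  n * n + 1 + (4 + 4 * n)
    ≡⟨ solve 1 (λ m → m :* m :+ con 1 :+ (con 4 :+ con 4 :* m) := (con 2 :+ m) :* (con 2 :+ m) :+ con 1) refl n ⟩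
  (2 + n) * (2 + n) + 1 ∎
  where
  open ≤-Reasoning
  B = ∑ n (λ d → ∣ 2 * d - n ∣)
  ∣2n-n∣≡n : ∣ 2 * n - n ∣ ≡ n
  ∣2n-n∣≡n = trans (cong (λ x → ∣ n + x - n ∣) (+-identityʳ n))
                   (trans (∣-∣-comm (n + n) n) (∣m-m+n∣≡n n n))

2∣a-b∣≤∣2a-n∣+∣2b-n∣ : ∀ n a b → 2 * ∣ a - b ∣ ≤ ∣ 2 * a - n ∣ + ∣ 2 * b - n ∣
2∣a-b∣≤∣2a-n∣+∣2b-n∣ n a b = begin
  2 * ∣ a - b ∣                  ≡⟨ *-distribˡ-∣-∣ 2 a b ⟩
  ∣ 2 * a - 2 * b ∣              ≤⟨ ∣-∣-triangle (2 * a) n (2 * b) ⟩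
  ∣ 2 * a - n ∣ + ∣ n - 2 * b ∣  ≡⟨ cong (∣ 2 * a - n ∣ +_) (∣-∣-comm n (2 * b)) ⟩
  ∣ 2 * a - n ∣ + ∣ 2 * b - n ∣  ∎
  where open ≤-Reasoning

∣2a-n∣≡∣2b-n∣ : ∀ {n a b} → a + b ≡ n → ∣ 2 * a - n ∣ ≡ ∣ 2 * b - n ∣
∣2a-n∣≡∣2b-n∣ {n} {a} {b} a+b≡n = trans (∣a-b∣≡∣d-c∣ (2 * a) n 2a+2b≡n+n) (∣-∣-comm n (2 * b))
  where
  2a+2b≡n+n : 2 * a + 2 * b ≡ n + n
  2a+2b≡n+n = trans (sym (*-distribˡ-+ 2 a b)) (trans (cong (2 *_) a+b≡n) (cong (n +_) (+-identityʳ n)))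

[b+[n∸a]]%n≡b∸a : ∀ {a b n} .{{_ : NonZero n}} → a ≤ b → b < n → (b + (n ∸ a)) % n ≡ b ∸ a
[b+[n∸a]]%n≡b∸a {a} {b} {n} a≤b b<n = begin
  (b + (n ∸ a)) % n        ≡⟨ cong (_% n) (+-∸-assoc b a≤n) ⟨
  (b + n ∸ a) % n          ≡⟨ cong (λ x → x % n) (+-∸-comm n a≤b) ⟩
  (b ∸ a + n) % n          ≡⟨ [m+n]%n≡m%n (b ∸ a) n ⟩
  (b ∸ a) % n              ≡⟨ m<n⇒m%n≡m (≤-<-trans (m∸n≤m b a) b<n) ⟩
  b ∸ a                    ∎
  where
  open ≡-Reasoning
  a≤n = ≤-trans a≤b (<⇒≤ b<n)

private
  [b+[n∸a]]%n+[a+[n∸b]]%n≡n-< : ∀ {a b n} .{{_ : NonZero n}} → a < b → b < n →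
                                (b + (n ∸ a)) % n + (a + (n ∸ b)) % n ≡ n
  [b+[n∸a]]%n+[a+[n∸b]]%n≡n-< {a} {b} {n} a<b b<n = begin
    (b + (n ∸ a)) % n + (a + (n ∸ b)) % n  ≡⟨ cong₂ _+_ ([b+[n∸a]]%n≡b∸a (<⇒≤ a<b) b<n) (m<n⇒m%n≡m a+[n∸b]<n) ⟩
    b ∸ a + (a + (n ∸ b))                   ≡⟨ +-assoc (b ∸ a) a _ ⟨
    b ∸ a + a + (n ∸ b)                     ≡⟨ cong (_+ (n ∸ b)) (m∸n+n≡m (<⇒≤ a<b)) ⟩
    b + (n ∸ b)                             ≡⟨ m+[n∸m]≡n (<⇒≤ b<n) ⟩
    n                                       ∎
    where
    open ≡-Reasoning
    a+[n∸b]<n : a + (n ∸ b) < n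
    a+[n∸b]<n = <-≤-trans (+-monoˡ-< (n ∸ b) a<b) (≤-reflexive (m+[n∸m]≡n (<⇒≤ b<n)))

[b+[n∸a]]%n+[a+[n∸b]]%n≡n : ∀ {a b n} .{{_ : NonZero n}} → a < n → b < n → a ≢ b →
                            (b + (n ∸ a)) % n + (a + (n ∸ b)) % n ≡ n
[b+[n∸a]]%n+[a+[n∸b]]%n≡n {a} {b} {n} a<n b<n a≢b with <-cmp a b
... | tri< a<b _ _ = [b+[n∸a]]%n+[a+[n∸b]]%n≡n-< a<b b<n
... | tri≈ _ a≡b _ = contradiction a≡b a≢b
... | tri> _ _ b<a = trans (+-comm ((b + (n ∸ a)) % n) _) ([b+[n∸a]]%n+[a+[n∸b]]%n≡n-< b<a a<n)

n[n²+1]≡n[n∸1]²+2n² : ∀ n → n * (n * n + 1) ≡ n * ((n ∸ 1) * (n ∸ 1)) + 2 * (n * n)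
n[n²+1]≡n[n∸1]²+2n² zero    = refl
n[n²+1]≡n[n∸1]²+2n² (suc m) = solve 1 (λ m → (con 1 :+ m) :* ((con 1 :+ m) :* (con 1 :+ m) :+ con 1)
  := (con 1 :+ m) :* (m :* m) :+ con 2 :* ((con 1 :+ m) :* (con 1 :+ m))) refl m

m*n≤o⇒m≤o/n : ∀ m n {o} .{{_ : NonZero n}} → m * n ≤ o → m ≤ o / n
m*n≤o⇒m≤o/n m n m*n≤o = subst (_≤ _) (m*n/n≡m m n) (/-monoˡ-≤ n m*n≤o)

increasing-gap : ∀ (f : ℕ → ℕ) k → (∀ j → j < k → f j < f (suc j)) → ∀ i d → i + d ≤ k → f i + d ≤ f (i + d)
increasing-gap f k increasing i zero    _ = ≤-reflexive (trans (+-identityʳ (f i)) (cong f (sym (+-identityʳ i))))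
increasing-gap f k increasing i (suc d) i+d+1≤k = begin
  f i + suc d         ≡⟨ +-suc (f i) d ⟩
  suc (f i + d)       ≤⟨ s≤s (increasing-gap f k increasing i d (≤-trans (m≤n+m (i + d) 1) i+d<k)) ⟩
  suc (f (i + d))     ≤⟨ increasing (i + d) i+d<k ⟩
  f (suc (i + d))     ≡⟨ cong f (+-suc i d) ⟨
  f (i + suc d)       ∎
  where
  open ≤-Reasoning
  i+d<k : i + d < k
  i+d<k = subst (_≤ k) (+-suc i d) i+d+1≤k

increasing-pinned : ∀ (f : ℕ → ℕ) k → (∀ j → j < k → f j < f (suc j)) → f k ≤ f 0 + k →
                    ∀ j → j ≤ k → f j ≡ f 0 + j
increasing-pinned f k increasing fk≤ j j≤k = ≤-antisym upper (increasing-gap f k increasing 0 j j≤k)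
  where
  upper : f j ≤ f 0 + j
  upper = +-cancelʳ-≤ (k ∸ j) _ _ (begin
    f j + (k ∸ j)       ≤⟨ increasing-gap f k increasing j (k ∸ j) (≤-reflexive (m+[n∸m]≡n j≤k)) ⟩
    f (j + (k ∸ j))     ≡⟨ cong f (m+[n∸m]≡n j≤k) ⟩
    f k                 ≤⟨ fk≤ ⟩
    f 0 + k             ≡⟨ cong (f 0 +_) (m+[n∸m]≡n j≤k) ⟨
    f 0 + (j + (k ∸ j)) ≡⟨ +-assoc (f 0) j _ ⟨
    f 0 + j + (k ∸ j)   ∎)
    where open ≤-Reasoning

module Modular (n : ℕ) .{{_ : NonZero n}} where

  0<n : 0 < n
  0<n = >-nonZero⁻¹ n

  infix 4 _≋_
  _≋_ : ℕ → ℕ → Set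
  a ≋ b = a % n ≡ b % n

  ≋-setoid : Setoid 0ℓ 0ℓ
  ≋-setoid = On.setoid (setoid ℕ) (_% n)

  module ≋-Reasoning = SetoidReasoning ≋-setoid

  %-≋ : ∀ a → a % n ≋ a
  %-≋ a = m%n%n≡m%n a n

  +n-≋ : ∀ a → a + n ≋ a
  +n-≋ a = [m+n]%n≡m%n a n

  +-cong-≋ : ∀ {a b c d} → a ≋ b → c ≋ d → a + c ≋ b + d
  +-cong-≋ {a} {b} {c} {d} a≋b c≋d = begin
    (a + c) % n              ≡⟨ %-distribˡ-+ a c n ⟩
    (a % n + c % n) % n      ≡⟨ cong₂ (λ x y → (x + y) % n) a≋b c≋d ⟩
    (b % n + d % n) % n      ≡⟨ %-distribˡ-+ b d n ⟨
    (b + d) % n              ∎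
    where open ≡-Reasoning

  +-congˡ-≋ : ∀ a {b c} → b ≋ c → a + b ≋ a + c
  +-congˡ-≋ a = +-cong-≋ {a} refl

  ≋⇒≡ : ∀ {a b} → a < n → b < n → a ≋ b → a ≡ b
  ≋⇒≡ a<n b<n a≋b = trans (sym (m<n⇒m%n≡m a<n)) (trans a≋b (m<n⇒m%n≡m b<n))

  neg : ℕ → ℕ
  neg a = n ∸ a % n

  +-neg-≋ : ∀ a → a + neg a ≋ 0
  +-neg-≋ a = begin
    a + neg a          ≈⟨ +-cong-≋ (%-≋ a) refl ⟨
    a % n + neg a      ≡⟨ m+[n∸m]≡n (m%n≤n a n) ⟩
    n                  ≈⟨ +n-≋ 0 ⟩
    0                  ∎
    where open ≋-Reasoning

  +-cancelʳ-≋ : ∀ {a b} c → a + c ≋ b + c → a ≋ b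
  +-cancelʳ-≋ {a} {b} c a+c≋b+c = begin
    a                  ≡⟨ +-identityʳ a ⟨
    a + 0              ≈⟨ +-congˡ-≋ a (+-neg-≋ c) ⟨
    a + (c + neg c)    ≡⟨ +-assoc a c _ ⟨
    a + c + neg c      ≈⟨ +-cong-≋ a+c≋b+c refl ⟩
    b + c + neg c      ≡⟨ +-assoc b c _ ⟩
    b + (c + neg c)    ≈⟨ +-congˡ-≋ b (+-neg-≋ c) ⟩
    b + 0              ≡⟨ +-identityʳ b ⟩
    b                  ∎
    where open ≋-Reasoning

  %-shift : ∀ a b k → (b + k) % n ≡ ((a + k) % n + (b + neg a) % n) % n
  %-shift a b k = sym (begin
    (a + k) % n + (b + neg a) % n    ≈⟨ +-cong-≋ (%-≋ (a + k)) (%-≋ (b + neg a)) ⟩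
    a + k + (b + neg a)              ≡⟨ solve 4 (λ a k b m → a :+ k :+ (b :+ m) := b :+ k :+ (a :+ m)) refl a k b (neg a) ⟩
    b + k + (a + neg a)              ≈⟨ +-congˡ-≋ (b + k) (+-neg-≋ a) ⟩
    b + k + 0                        ≡⟨ +-identityʳ (b + k) ⟩
    b + k                            ∎)
    where open ≋-Reasoning

  toℕ-mod : ∀ a → toℕ (a mod n) ≡ a % n
  toℕ-mod a = toℕ-fromℕ< (m%n<n a n)

  mod-cong : ∀ {a b} → a ≋ b → a mod n ≡ b mod n
  mod-cong {a} {b} a≋b = toℕ-injective (trans (toℕ-mod a) (trans a≋b (sym (toℕ-mod b))))

  toℕ-mod-inverse : (i : Fin n) → toℕ i mod n ≡ i
  toℕ-mod-inverse i = toℕ-injective (trans (toℕ-mod (toℕ i)) (m<n⇒m%n≡m (toℕ<n i)))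

  next-mod : ∀ a → next (a mod n) ≡ suc a mod n
  next-mod a = mod-cong (+-congˡ-≋ 1 (trans (cong (_% n) (toℕ-mod a)) (%-≋ a)))

  +-mod-injective : ∀ r {j k} → j < n → k < n → (r + j) mod n ≡ (r + k) mod n → j ≡ k
  +-mod-injective r {j} {k} j<n k<n eq = ≋⇒≡ j<n k<n (+-cancelʳ-≋ r (begin
    (j + r) % n        ≡⟨ cong (_% n) (+-comm j r) ⟩
    (r + j) % n        ≡⟨ toℕ-mod (r + j) ⟨
    toℕ ((r + j) mod n) ≡⟨ cong toℕ eq ⟩
    toℕ ((r + k) mod n) ≡⟨ toℕ-mod (r + k) ⟩
    (r + k) % n        ≡⟨ cong (_% n) (+-comm r k) ⟩
    (k + r) % n        ∎))
    where open ≡-Reasoning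

  ∑-permute : (π : Fin n → Fin n) → Bijective _≡_ _≡_ π → ∀ (G : ℕ → ℕ) →
              ∑ n (λ j → G (toℕ (π (j mod n)))) ≡ ∑ n G
  ∑-permute π (injective , surjective) G = begin
    ∑ n (λ j → G (toℕ (π (j mod n))))      ≡⟨ ∑≡FinSum n _ ⟩
    FinSum.sum {n} (λ i → G (toℕ (π (toℕ i mod n))))
      ≡⟨ FinSum.sum-cong-≗ {n} (λ i → cong (G ∘ toℕ ∘ π) (toℕ-mod-inverse i)) ⟩
    FinSum.sum {n} (λ i → G (toℕ (π i)))   ≡⟨ FinSum.∑-permute {n} {n} (G ∘ toℕ) ρ ⟨
    FinSum.sum {n} (G ∘ toℕ)               ≡⟨ ∑≡FinSum n G ⟨
    ∑ n G                                  ∎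
    where
    open ≡-Reasoning
    π⁻¹ : Fin n → Fin n
    π⁻¹ y = proj₁ (surjective y)
    ρ = permutation π π⁻¹ (λ y → proj₂ (surjective y) refl) (λ x → injective (proj₂ (surjective (π x)) refl))
    ∑≡FinSum : ∀ m (f : ℕ → ℕ) → ∑ m f ≡ FinSum.sum {m} (f ∘ toℕ)
    ∑≡FinSum zero    f = refl
    ∑≡FinSum (suc m) f = cong (f 0 +_) (∑≡FinSum m (f ∘ suc))

∑-rotate : ∀ n .{{_ : NonZero n}} c (f : ℕ → ℕ) → ∑ n (λ a → f ((c + a) % n)) ≡ ∑ n f
∑-rotate (suc m) zero    f = ∑-cong (suc m) (λ a a<n → cong f (m<n⇒m%n≡m a<n))
∑-rotate (suc m) (suc c) f = begin
  ∑ n (λ a → f ((suc c + a) % n))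
    ≡⟨ ∑-cong n (λ a _ → cong f (trans (cong (_% n) (sym (+-suc c a))) (sym (+-congˡ-≋ c {suc a % n} (%-≋ (suc a)))))) ⟩
  ∑ n (λ a → g (suc a % n))             ≡⟨ ∑-last m (g ∘ (_% n) ∘ suc) ⟩
  ∑ m (λ a → g (suc a % n)) + g (n % n)
    ≡⟨ cong₂ _+_ (∑-cong m (λ a a<m → cong g (m<n⇒m%n≡m (s<s a<m)))) (cong g (n%n≡0 n)) ⟩
  ∑ m (g ∘ suc) + g 0                   ≡⟨ +-comm _ (g 0) ⟩
  ∑ n g                                 ≡⟨ ∑-rotate n c f ⟩
  ∑ n f                                 ∎
  where
  open ≡-Reasoning
  open Modular (suc m)
  n = suc m
  g : ℕ → ℕ
  g a = f ((c + a) % n)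

module Residues {n : ℕ} .{{_ : NonZero n}} (π : Fin n → Fin n) (bij : Bijective _≡_ _≡_ π) where
  open Modular n

  P : ℕ → ℕ
  P j = toℕ (π (j mod n))

  P<n : ∀ j → P j < n
  P<n j = toℕ<n (π (j mod n))

  P-injective : ∀ {i j} → i < n → j < n → P i ≡ P j → i ≡ j
  P-injective i<n j<n eq = +-mod-injective 0 i<n j<n (proj₁ bij (toℕ-injective eq))

  diff : ℕ → ℕ → ℕ
  diff i j = (P j + (n ∸ P i)) % n

  diff-self : ∀ i → diff i i ≡ 0
  diff-self i = trans (cong (_% n) (m+[n∸m]≡n (<⇒≤ (P<n i)))) (n%n≡0 n)

  diff-complement : ∀ {i j} → i < n → j < n → i ≢ j → diff i j + diff j i ≡ n
  diff-complement i<n j<n i≢j = [b+[n∸a]]%n+[a+[n∸b]]%n≡n (P<n _) (P<n _) (i≢j ∘ P-injective i<n j<n)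

  ∑-diff-row : ∀ i (G : ℕ → ℕ) → ∑ n (G ∘ diff i) ≡ ∑ n G
  ∑-diff-row i G = begin
    ∑ n (λ j → G ((P j + (n ∸ P i)) % n))   ≡⟨ ∑-permute π bij (λ x → G ((x + (n ∸ P i)) % n)) ⟩
    ∑ n (λ x → G ((x + (n ∸ P i)) % n))     ≡⟨ ∑-cong n (λ x _ → cong (λ y → G (y % n)) (+-comm x _)) ⟩
    ∑ n (λ x → G (((n ∸ P i) + x) % n))     ≡⟨ ∑-rotate n (n ∸ P i) G ⟩
    ∑ n G                                   ∎
    where open ≡-Reasoning

  ∑pairs-∣2diff-n∣-≤ : 4 * ∑pairs n (λ i j → ∣ 2 * diff i j - n ∣) ≤ n * ((n ∸ 1) * (n ∸ 1))
  ∑pairs-∣2diff-n∣-≤ = +-cancelʳ-≤ (2 * (n * n)) _ _ (begin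
    4 * S + 2 * (n * n)                      ≡⟨ solve 2 (λ s m → con 4 :* s :+ con 2 :* m := con 2 :* (con 2 :* s :+ m)) refl S (n * n) ⟩
    2 * (2 * S + n * n)                      ≡⟨ cong (λ x → 2 * (2 * S + x)) diagonal ⟨
    2 * (2 * S + ∑ n (λ i → Q i i))          ≡⟨ cong (2 *_) (∑pairs-symmetric n Q Q-symmetric) ⟩
    2 * ∑ n (λ i → ∑ n (Q i))                ≡⟨ cong (2 *_) (trans (∑-cong n (λ i _ → ∑-diff-row i _)) (∑-const n B)) ⟩
    2 * (n * B)                              ≡⟨ solve 2 (λ m b → con 2 :* (m :* b) := m :* (con 2 :* b)) refl n B ⟩
    n * (2 * B)                              ≤⟨ *-monoʳ-≤ n (∑-∣2d-n∣-≤ n) ⟩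
    n * (n * n + 1)                          ≡⟨ n[n²+1]≡n[n∸1]²+2n² n ⟩
    n * ((n ∸ 1) * (n ∸ 1)) + 2 * (n * n)    ∎)
    where
    open ≤-Reasoning
    Q : ℕ → ℕ → ℕ
    Q i j = ∣ 2 * diff i j - n ∣
    S = ∑pairs n Q
    B = ∑ n (λ d → ∣ 2 * d - n ∣)
    diagonal : ∑ n (λ i → Q i i) ≡ n * n
    diagonal = trans (∑-cong n (λ i _ → cong (λ d → ∣ 2 * d - n ∣) (diff-self i))) (∑-const n n)
    Q-symmetric : ∀ i j → i < j → j < n → Q i j ≡ Q j i
    Q-symmetric i j i<j j<n = ∣2a-n∣≡∣2b-n∣ {a = diff i j} {b = diff j i} (diff-complement (<-trans i<j j<n) j<n (<⇒≢ i<j))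

module _ {n : ℕ} .{{_ : NonZero n}} (π : Fin n → Fin n) (bij : Bijective _≡_ _≡_ π) where
  open Residues π bij
  private
    open module Id = Residues {n} id (Identity.bijective _≡_) using () renaming (diff to gap)
    open Modular n

  gap≡∸ : ∀ {i j} → i < j → j < n → gap i j ≡ j ∸ i
  gap≡∸ {i} {j} i<j j<n = begin
    (toℕ (j mod n) + (n ∸ toℕ (i mod n))) % n   ≡⟨ cong₂ (λ a b → (a + (n ∸ b)) % n) (mod-id j<n) (mod-id (<-trans i<j j<n)) ⟩
    (j + (n ∸ i)) % n                           ≡⟨ [b+[n∸a]]%n≡b∸a (<⇒≤ i<j) j<n ⟩
    j ∸ i                                       ∎
    where
    open ≡-Reasoning
    mod-id : ∀ {a} → a < n → toℕ (a mod n) ≡ a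
    mod-id {a} a<n = trans (toℕ-mod a) (m<n⇒m%n≡m a<n)

  ∑pairs-∣diff-∸∣-≤ : 4 * ∑pairs n (λ i j → ∣ diff i j - (j ∸ i) ∣) ≤ n * ((n ∸ 1) * (n ∸ 1))
  ∑pairs-∣diff-∸∣-≤ = *-cancelˡ-≤ 2 (begin
    2 * (4 * T)                                   ≡⟨ solve 1 (λ t → con 2 :* (con 4 :* t) := con 4 :* (con 2 :* t)) refl T ⟩
    4 * (2 * T)                                   ≡⟨ cong (4 *_) (*-distribˡ-∑pairs n 2 _) ⟩
    4 * ∑pairs n (λ i j → 2 * ∣ diff i j - (j ∸ i) ∣)
      ≤⟨ *-monoʳ-≤ 4 (∑pairs-mono-≤ n triangle) ⟩
    4 * ∑pairs n (λ i j → δ i j + δ₀ i j)     ≡⟨ cong (4 *_) (∑pairs-distrib-+ n δ δ₀) ⟩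
    4 * (∑pairs n δ + ∑pairs n δ₀)            ≡⟨ *-distribˡ-+ 4 (∑pairs n δ) _ ⟩
    4 * ∑pairs n δ + 4 * ∑pairs n δ₀          ≤⟨ +-mono-≤ ∑pairs-∣2diff-n∣-≤ Id.∑pairs-∣2diff-n∣-≤ ⟩
    n * N² + n * N²                               ≡⟨ solve 1 (λ x → x :+ x := con 2 :* x) refl (n * N²) ⟩
    2 * (n * N²)                                  ∎)
    where
    open ≤-Reasoning
    N² = (n ∸ 1) * (n ∸ 1)
    T = ∑pairs n (λ i j → ∣ diff i j - (j ∸ i) ∣)
    δ δ₀ : ℕ → ℕ → ℕ
    δ i j = ∣ 2 * diff i j - n ∣
    δ₀ i j = ∣ 2 * gap i j - n ∣
    triangle : ∀ i j → i < j → j < n → 2 * ∣ diff i j - (j ∸ i) ∣ ≤ δ i j + δ₀ i j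
    triangle i j i<j j<n = subst (λ g → 2 * ∣ diff i j - g ∣ ≤ δ i j + δ₀ i j) (gap≡∸ i<j j<n)
                                 (2∣a-b∣≤∣2a-n∣+∣2b-n∣ n (diff i j) (gap i j))

infixl 9 _‼_
_‼_ : List ℕ → ℕ → ℕ
[]       ‼ _     = 0
(x ∷ xs) ‼ zero  = x
(x ∷ xs) ‼ suc j = xs ‼ j

swapAt : ℕ → List ℕ → List ℕ
swapAt zero    (a ∷ b ∷ xs) = b ∷ a ∷ xs
swapAt (suc j) (a ∷ xs)     = a ∷ swapAt j xs
swapAt _       xs           = xs

swapAt-↭ : ∀ j xs → swapAt j xs ↭ xs
swapAt-↭ zero    []           = ↭-refl
swapAt-↭ zero    (a ∷ [])     = ↭-refl
swapAt-↭ zero    (a ∷ b ∷ xs) = ↭-swap b a ↭-refl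
swapAt-↭ (suc j) []           = ↭-refl
swapAt-↭ (suc j) (a ∷ xs)     = ↭-prep a (swapAt-↭ j xs)

swapAt-‼-left : ∀ j xs → suc j < length xs → swapAt j xs ‼ j ≡ xs ‼ suc j
swapAt-‼-left zero    (a ∷ [])     (s≤s ())
swapAt-‼-left zero    (a ∷ b ∷ xs) _         = refl
swapAt-‼-left (suc j) (a ∷ xs)     (s≤s j<l) = swapAt-‼-left j xs j<l

swapAt-‼-right : ∀ j xs → suc j < length xs → swapAt j xs ‼ suc j ≡ xs ‼ j
swapAt-‼-right zero    (a ∷ [])     (s≤s ())
swapAt-‼-right zero    (a ∷ b ∷ xs) _         = refl
swapAt-‼-right (suc j) (a ∷ xs)     (s≤s j<l) = swapAt-‼-right j xs j<l

swapAt-‼-other : ∀ j xs {k} → k ≢ j → k ≢ suc j → swapAt j xs ‼ k ≡ xs ‼ k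
swapAt-‼-other zero    []           _   _     = refl
swapAt-‼-other zero    (a ∷ [])     _   _     = refl
swapAt-‼-other zero    (a ∷ b ∷ xs) {zero}        k≢0 _   = contradiction refl k≢0
swapAt-‼-other zero    (a ∷ b ∷ xs) {suc zero}    _   k≢1 = contradiction refl k≢1
swapAt-‼-other zero    (a ∷ b ∷ xs) {suc (suc k)} _   _   = refl
swapAt-‼-other (suc j) []           _   _     = refl
swapAt-‼-other (suc j) (a ∷ xs)     {zero}  _   _   = refl
swapAt-‼-other (suc j) (a ∷ xs)     {suc k} k≢j k≢j+1 = swapAt-‼-other j xs (k≢j ∘ cong suc) (k≢j+1 ∘ cong suc)

++-‼-< : ∀ xs {c k} → k < length xs → (xs ++ [ c ]) ‼ k ≡ xs ‼ k
++-‼-< (x ∷ xs) {k = zero}  _         = refl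
++-‼-< (x ∷ xs) {k = suc k} (s≤s k<l) = ++-‼-< xs k<l

++-‼-length : ∀ xs {c} → (xs ++ [ c ]) ‼ length xs ≡ c
++-‼-length []       = refl
++-‼-length (x ∷ xs) = ++-‼-length xs

applyUpTo-‼ : ∀ (f : ℕ → ℕ) m {j} → j < m → applyUpTo f m ‼ j ≡ f j
applyUpTo-‼ f (suc m) {zero}  _         = refl
applyUpTo-‼ f (suc m) {suc j} (s≤s j<m) = applyUpTo-‼ (f ∘ suc) m j<m

sum-map-applyUpTo : ∀ (g f : ℕ → ℕ) m → sum (map g (applyUpTo f m)) ≡ ∑ m (g ∘ f)
sum-map-applyUpTo g f zero    = refl
sum-map-applyUpTo g f (suc m) = cong (g (f 0) +_) (sum-map-applyUpTo g (f ∘ suc) m)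

transpose-matchˡ : ∀ {m} (i j : Fin m) → transpose i j i ≡ j
transpose-matchˡ i j with i Fin.≟ i
... | yes _   = refl
... | no  i≢i = contradiction refl i≢i

transpose-matchʳ : ∀ {m} (i j : Fin m) → transpose i j j ≡ i
transpose-matchʳ i j with j Fin.≟ i
... | yes j≡i = j≡i
... | no  _ with j Fin.≟ j
...   | yes _   = refl
...   | no  j≢j = contradiction refl j≢j

transpose-mismatch : ∀ {m} {i j k : Fin m} → k ≢ i → k ≢ j → transpose i j k ≡ k
transpose-mismatch {i = i} {j} {k} k≢i k≢j with k Fin.≟ i
... | yes k≡i = contradiction k≡i k≢i
... | no  _ with k Fin.≟ j
...   | yes k≡j = contradiction k≡j k≢j
...   | no  _   = refl

swapAdj-injective : ∀ {n} .{{_ : NonZero n}} {σ : Labeling n} i → Injective _≡_ _≡_ σ → Injective _≡_ _≡_ (swapAdj i σ)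
swapAdj-injective i σ-injective eq =
  trans (sym (transpose-inverse (next i) i)) (trans (cong (transpose (next i) i) (σ-injective eq)) (transpose-inverse (next i) i))

module Lifting (n : ℕ) .{{_ : NonZero n}} where
  open Modular n

  -- The inversions per period between the n-periodic extensions of a value a and a value b to its right.
  crossings : ℕ → ℕ → ℕ
  crossings a b with a ≤? b
  ... | yes _ = (b ∸ a) / n
  ... | no  _ = suc ((a ∸ b) / n)

  crossings-≤ : ∀ {a b} → a ≤ b → crossings a b ≡ (b ∸ a) / n
  crossings-≤ {a} {b} a≤b with a ≤? b
  ... | yes _   = refl
  ... | no  a≰b = contradiction a≤b a≰b

  crossings-> : ∀ {a b} → b < a → crossings a b ≡ suc ((a ∸ b) / n)
  crossings-> {a} {b} b<a with a ≤? b
  ... | yes a≤b = contradiction a≤b (<⇒≱ b<a)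
  ... | no  _   = refl

  crossings-swap : ∀ {a b} → b < a → crossings a b ≡ suc (crossings b a)
  crossings-swap b<a = trans (crossings-> b<a) (cong suc (sym (crossings-≤ (<⇒≤ b<a))))

  crossings-+ : ∀ c a b → crossings (c + a) (c + b) ≡ crossings a b
  crossings-+ c a b with ≤-<-connex a b
  ... | inj₁ a≤b = begin
    crossings (c + a) (c + b)       ≡⟨ crossings-≤ (+-monoʳ-≤ c a≤b) ⟩
    (c + b ∸ (c + a)) / n           ≡⟨ cong (_/ n) ([m+n]∸[m+o]≡n∸o c b a) ⟩
    (b ∸ a) / n                     ≡⟨ crossings-≤ a≤b ⟨
    crossings a b                   ∎
    where open ≡-Reasoning
  ... | inj₂ b<a = begin
    crossings (c + a) (c + b)       ≡⟨ crossings-> (+-monoʳ-< c b<a) ⟩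
    suc ((c + a ∸ (c + b)) / n)     ≡⟨ cong (λ x → suc (x / n)) ([m+n]∸[m+o]≡n∸o c a b) ⟩
    suc ((a ∸ b) / n)               ≡⟨ crossings-> b<a ⟨
    crossings a b                   ∎
    where open ≡-Reasoning

  crossings-rotate : ∀ {a b} → a % n ≢ b % n → crossings a b ≡ crossings b (a + n)
  crossings-rotate {a} {b} a≢b with ≤-<-connex a b
  ... | inj₂ b<a = begin
    crossings a b                   ≡⟨ crossings-> b<a ⟩
    suc ((a ∸ b) / n)               ≡⟨ [m+n]/n≡1+m/n (a ∸ b) n ⟨
    (a ∸ b + n) / n                 ≡⟨ cong (_/ n) (+-∸-comm n (<⇒≤ b<a)) ⟨
    (a + n ∸ b) / n                 ≡⟨ crossings-≤ (≤-trans (<⇒≤ b<a) (m≤m+n a n)) ⟨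
    crossings b (a + n)             ∎
    where open ≡-Reasoning
  ... | inj₁ a≤b with <-cmp b (a + n)
  ...   | tri< b<a+n _ _ = begin
    crossings a b                   ≡⟨ crossings-≤ a≤b ⟩
    (b ∸ a) / n                     ≡⟨ m<n⇒m/n≡0 (subst (b ∸ a <_) (m+n∸m≡n a n) (∸-monoˡ-< b<a+n a≤b)) ⟩
    0                               ≡⟨ m<n⇒m/n≡0 (subst (a + n ∸ b <_) (m+n∸m≡n a n) (∸-monoʳ-< a<b (<⇒≤ b<a+n))) ⟨
    (a + n ∸ b) / n                 ≡⟨ crossings-≤ (<⇒≤ b<a+n) ⟨
    crossings b (a + n)             ∎
    where
    open ≡-Reasoning
    a<b : a < b
    a<b = ≤∧≢⇒< a≤b (λ a≡b → a≢b (cong (_% n) a≡b))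
  ...   | tri≈ _ b≡a+n _ = contradiction (sym (trans (cong (_% n) b≡a+n) (+n-≋ a))) a≢b
  ...   | tri> _ _ a+n<b = begin
    crossings a b                   ≡⟨ crossings-≤ a≤b ⟩
    (b ∸ a) / n                     ≡⟨ m/n≡1+[m∸n]/n (subst (_≤ b ∸ a) (m+n∸m≡n a n) (∸-monoˡ-≤ a (<⇒≤ a+n<b))) ⟩
    suc ((b ∸ a ∸ n) / n)           ≡⟨ cong (λ x → suc (x / n)) (∸-+-assoc b a n) ⟩
    suc ((b ∸ (a + n)) / n)         ≡⟨ crossings-> a+n<b ⟨
    crossings b (a + n)             ∎
    where open ≡-Reasoning

  ∑-crossings-cyclic-split : ∀ {g e} → e < n →
    ∑ n (λ x → crossings x (g + (x + e) % n)) ≡ (n ∸ e) * ((g + e) / n) + e * crossings (n ∸ e) g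
  ∑-crossings-cyclic-split {g} {e} e<n = begin
    ∑ n F                                          ≡⟨ cong (λ k → ∑ k F) (m∸n+n≡m (<⇒≤ e<n)) ⟨
    ∑ (m + e) F                                    ≡⟨ ∑-split m e F ⟩
    ∑ m F + ∑ e (F ∘ (m +_))                       ≡⟨ cong₂ _+_ (∑-cong m below) (∑-cong e above) ⟩
    ∑ m (λ _ → (g + e) / n) + ∑ e (λ _ → crossings m g) ≡⟨ cong₂ _+_ (∑-const m _) (∑-const e _) ⟩
    m * ((g + e) / n) + e * crossings m g          ∎
    where
    open ≡-Reasoning
    m = n ∸ e
    F : ℕ → ℕ
    F x = crossings x (g + (x + e) % n)
    below : ∀ x → x < m → F x ≡ (g + e) / n
    below x x<m = begin
      crossings x (g + (x + e) % n)  ≡⟨ cong (λ y → crossings x (g + y)) (m<n⇒m%n≡m x+e<n) ⟩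
      crossings x (g + (x + e))      ≡⟨ cong (crossings x) (solve 3 (λ g x e → g :+ (x :+ e) := x :+ (g :+ e)) refl g x e) ⟩
      crossings x (x + (g + e))      ≡⟨ crossings-≤ (m≤m+n x (g + e)) ⟩
      (x + (g + e) ∸ x) / n          ≡⟨ cong (_/ n) (m+n∸m≡n x (g + e)) ⟩
      (g + e) / n                    ∎
      where
      x+e<n : x + e < n
      x+e<n = subst (x + e <_) (m∸n+n≡m (<⇒≤ e<n)) (+-monoˡ-< e x<m)
    above : ∀ y → y < e → F (m + y) ≡ crossings m g
    above y y<e = begin
      crossings (m + y) (g + (m + y + e) % n)  ≡⟨ cong (λ z → crossings (m + y) (g + z)) m+y+e%n≡y ⟩
      crossings (m + y) (g + y)                ≡⟨ cong₂ crossings (+-comm m y) (+-comm g y) ⟩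
      crossings (y + m) (y + g)                ≡⟨ crossings-+ y m g ⟩
      crossings m g                            ∎
      where
      m+y+e%n≡y : (m + y + e) % n ≡ y
      m+y+e%n≡y = begin
        (m + y + e) % n    ≡⟨ cong (_% n) (solve 3 (λ m y e → m :+ y :+ e := y :+ (m :+ e)) refl m y e) ⟩
        (y + (m + e)) % n  ≡⟨ cong (λ k → (y + k) % n) (m∸n+n≡m (<⇒≤ e<n)) ⟩
        (y + n) % n        ≡⟨ +n-≋ y ⟩
        y % n              ≡⟨ m<n⇒m%n≡m (<-trans y<e e<n) ⟩
        y                  ∎

  cyclic-split-< : ∀ {g e} → g + e < n → (n ∸ e) * ((g + e) / n) + e * crossings (n ∸ e) g ≡ e
  cyclic-split-< {g} {e} g+e<n = begin
    (n ∸ e) * ((g + e) / n) + e * crossings (n ∸ e) g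
      ≡⟨ cong₂ (λ q c → (n ∸ e) * q + e * c) (m<n⇒m/n≡0 g+e<n) (crossings-> g<n∸e) ⟩
    (n ∸ e) * 0 + e * suc ((n ∸ e ∸ g) / n)
      ≡⟨ cong (_+ e * suc ((n ∸ e ∸ g) / n)) (*-zeroʳ (n ∸ e)) ⟩
    e * suc ((n ∸ e ∸ g) / n)
      ≡⟨ e*[1+[n∸e∸g]/n]≡e e (≤-<-trans (m≤n+m e g) g+e<n) ⟩
    e ∎
    where
    open ≡-Reasoning
    g<n∸e : g < n ∸ e
    g<n∸e = subst (_< n ∸ e) (m+n∸n≡m g e) (∸-monoˡ-< g+e<n (m≤n+m e g))
    e*[1+[n∸e∸g]/n]≡e : ∀ e → e < n → e * suc ((n ∸ e ∸ g) / n) ≡ e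
    e*[1+[n∸e∸g]/n]≡e zero      _   = refl
    e*[1+[n∸e∸g]/n]≡e (suc e-1) e<n = begin
      suc e-1 * suc ((n ∸ suc e-1 ∸ g) / n)
        ≡⟨ cong (λ q → suc e-1 * suc q) (m<n⇒m/n≡0 (≤-<-trans (m∸n≤m _ g) (∸-monoʳ-< z<s (<⇒≤ e<n)))) ⟩
      suc e-1 * 1
        ≡⟨ *-identityʳ (suc e-1) ⟩
      suc e-1 ∎

  cyclic-split-≥ : ∀ {g e} → g < n → e < n → n ≤ g + e → (n ∸ e) * ((g + e) / n) + e * crossings (n ∸ e) g ≡ n ∸ e
  cyclic-split-≥ {g} {e} g<n e<n n≤g+e = begin
    (n ∸ e) * ((g + e) / n) + e * crossings (n ∸ e) g
      ≡⟨ cong₂ (λ q c → (n ∸ e) * q + e * c) (n≤m<n+n⇒m/n≡1 n≤g+e (+-mono-< g<n e<n)) (crossings-≤ n∸e≤g) ⟩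
    (n ∸ e) * 1 + e * ((g ∸ (n ∸ e)) / n)
      ≡⟨ cong₂ (λ x y → x + e * y) (*-identityʳ (n ∸ e)) (m<n⇒m/n≡0 (≤-<-trans (m∸n≤m g (n ∸ e)) g<n)) ⟩
    n ∸ e + e * 0
      ≡⟨ trans (cong (n ∸ e +_) (*-zeroʳ e)) (+-identityʳ _) ⟩
    n ∸ e ∎
    where
    open ≡-Reasoning
    n∸e≤g : n ∸ e ≤ g
    n∸e≤g = subst (n ∸ e ≤_) (m+n∸n≡m g e) (∸-monoˡ-≤ e n≤g+e)

  ∑-crossings-cyclic : ∀ {g e} → g < n → e < n → ∑ n (λ x → crossings x (g + (x + e) % n)) ≡ ∣ (g + e) % n - g ∣
  ∑-crossings-cyclic {g} {e} g<n e<n with g + e <? n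
  ... | yes g+e<n = begin
    ∑ n (λ x → crossings x (g + (x + e) % n))  ≡⟨ trans (∑-crossings-cyclic-split e<n) (cyclic-split-< g+e<n) ⟩
    e                                         ≡⟨ ∣-∣-identityʳ e ⟨
    ∣ e - 0 ∣                                 ≡⟨ ∣a-b∣≡∣d-c∣ ((g + e) % n) g (trans (+-identityʳ _) (m<n⇒m%n≡m g+e<n)) ⟨
    ∣ (g + e) % n - g ∣                       ∎
    where open ≡-Reasoning
  ... | no  g+e≮n = begin
    ∑ n (λ x → crossings x (g + (x + e) % n))  ≡⟨ trans (∑-crossings-cyclic-split e<n) (cyclic-split-≥ g<n e<n n≤g+e) ⟩
    n ∸ e                                     ≡⟨ m≤n⇒∣m-n∣≡n∸m (<⇒≤ e<n) ⟨
    ∣ e - n ∣                                 ≡⟨ ∣a-b∣≡∣d-c∣ ((g + e) % n) g (n≤m<n+n⇒m%n+n≡m n≤g+e (+-mono-< g<n e<n)) ⟨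
    ∣ (g + e) % n - g ∣                       ∎
    where
    open ≡-Reasoning
    n≤g+e : n ≤ g + e
    n≤g+e = ≮⇒≥ g+e≮n

  cost : List ℕ → ℕ
  cost []       = 0
  cost (a ∷ xs) = sum (map (crossings a) xs) + cost xs

  cost-swapAt : ∀ j xs → suc j < length xs → xs ‼ suc j < xs ‼ j → cost xs ≡ suc (cost (swapAt j xs))
  cost-swapAt zero    (a ∷ [])     (s≤s ()) _
  cost-swapAt zero    (a ∷ b ∷ xs) _        b<a = begin
    crossings a b + A + (B + C)         ≡⟨ cong (λ x → x + A + (B + C)) (crossings-swap b<a) ⟩
    suc (crossings b a) + A + (B + C)
      ≡⟨ cong suc (solve 4 (λ x a b c → x :+ a :+ (b :+ c) := x :+ b :+ (a :+ c)) refl (crossings b a) A B C) ⟩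
    suc (crossings b a + B + (A + C))   ∎
    where
    open ≡-Reasoning
    A = sum (map (crossings a) xs)
    B = sum (map (crossings b) xs)
    C = cost xs
  cost-swapAt (suc j) (a ∷ xs)     (s≤s j<l) d = begin
    sum (map (crossings a) xs) + cost xs
      ≡⟨ cong₂ _+_ (sum-↭ (map⁺ (crossings a) (swapAt-↭ j xs))) (sym (cost-swapAt j xs j<l d)) ⟨
    sum (map (crossings a) (swapAt j xs)) + suc (cost (swapAt j xs))
      ≡⟨ +-suc _ _ ⟩
    suc (cost (swapAt (suc j) (a ∷ xs))) ∎
    where open ≡-Reasoning

  cost-snoc : ∀ xs c → cost (xs ++ [ c ]) ≡ cost xs + sum (map (λ b → crossings b c) xs)
  cost-snoc []       c = refl
  cost-snoc (a ∷ xs) c = begin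
    sum (map (crossings a) (xs ++ [ c ])) + cost (xs ++ [ c ])
      ≡⟨ cong₂ _+_ (trans (cong sum (map-++ (crossings a) xs [ c ])) (sum-++ (map (crossings a) xs) _)) (cost-snoc xs c) ⟩
    A + (crossings a c + 0) + (cost xs + B)
      ≡⟨ solve 4 (λ a x c b → a :+ (x :+ con 0) :+ (c :+ b) := a :+ c :+ (x :+ b)) refl A (crossings a c) (cost xs) B ⟩
    A + cost xs + (crossings a c + B) ∎
    where
    open ≡-Reasoning
    A = sum (map (crossings a) xs)
    B = sum (map (λ b → crossings b c) xs)

  sum-crossings-rotate : ∀ a xs → (∀ k → k < length xs → a % n ≢ xs ‼ k % n) →
                         sum (map (crossings a) xs) ≡ sum (map (λ b → crossings b (a + n)) xs)
  sum-crossings-rotate a []       _        = refl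
  sum-crossings-rotate a (b ∷ xs) distinct =
    cong₂ _+_ (crossings-rotate {a} {b} (distinct 0 z<s)) (sum-crossings-rotate a xs (λ k k<l → distinct (suc k) (s<s k<l)))

  cost-rotate : ∀ a xs → (∀ k → k < length xs → a % n ≢ xs ‼ k % n) → cost (a ∷ xs) ≡ cost (xs ++ [ a + n ])
  cost-rotate a xs distinct = begin
    sum (map (crossings a) xs) + cost xs                      ≡⟨ cong (_+ cost xs) (sum-crossings-rotate a xs distinct) ⟩
    sum (map (λ b → crossings b (a + n)) xs) + cost xs        ≡⟨ +-comm _ (cost xs) ⟩
    cost xs + sum (map (λ b → crossings b (a + n)) xs)        ≡⟨ cost-snoc xs (a + n) ⟨
    cost (xs ++ [ a + n ])                                    ∎
    where open ≡-Reasoning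

  cost-applyUpTo : ∀ (f : ℕ → ℕ) m → cost (applyUpTo f m) ≡ ∑pairs m (λ i j → crossings (f i) (f j))
  cost-applyUpTo f zero    = refl
  cost-applyUpTo f (suc m) = cong₂ _+_ (sum-map-applyUpTo (crossings (f 0)) (f ∘ suc) m) (cost-applyUpTo (f ∘ suc) m)

  record IsLift (σ : Labeling n) (r : ℕ) (xs : List ℕ) : Set where
    field
      length≡n : length xs ≡ n
      residue  : ∀ {j} → j < n → xs ‼ j % n ≡ toℕ (σ ((r + j) mod n))

  residue-injective : ∀ {σ r xs} → IsLift σ r xs → Injective _≡_ _≡_ σ →
                      ∀ {j k} → j < n → k < n → xs ‼ j % n ≡ xs ‼ k % n → j ≡ k
  residue-injective lift σ-injective {j} {k} j<n k<n eq =
    +-mod-injective _ j<n k<n (σ-injective (toℕ-injective (trans (sym (residue j<n)) (trans eq (residue k<n)))))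
    where open IsLift lift

  isLift-swapAt : ∀ {σ r xs j} → IsLift σ r xs → suc j < n → IsLift (swapAdj ((r + j) mod n) σ) r (swapAt j xs)
  isLift-swapAt {σ} {r} {xs} {j} lift j+1<n = record
    { length≡n = trans (↭-length (swapAt-↭ j xs)) length≡n
    ; residue  = λ k<n → let k′ , k′<n , value≡ , position≡ = swapped k<n in
        trans (cong (_% n) value≡) (trans (residue k′<n) (cong (toℕ ∘ σ) (sym position≡)))
    }
    where
    open IsLift lift
    i = (r + j) mod n
    j<n : j < n
    j<n = <-trans (n<1+n j) j+1<n
    j+1<l : suc j < length xs
    j+1<l = subst (suc j <_) (sym length≡n) j+1<n
    next-i : next i ≡ (r + suc j) mod n
    next-i = trans (next-mod (r + j)) (cong (_mod n) (sym (+-suc r j)))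
    swapped : ∀ {k} → k < n → ∃ λ k′ → k′ < n × swapAt j xs ‼ k ≡ xs ‼ k′ ×
                                        transpose i (next i) ((r + k) mod n) ≡ (r + k′) mod n
    swapped {k} k<n with k ≟ j | k ≟ suc j
    ... | yes refl | _        = suc j , j+1<n , swapAt-‼-left j xs j+1<l , trans (transpose-matchˡ i (next i)) next-i
    ... | no  _    | yes refl = j , j<n , swapAt-‼-right j xs j+1<l ,
                                trans (cong (transpose i (next i)) (sym next-i)) (transpose-matchʳ i (next i))
    ... | no  k≢j  | no k≢j+1 = k , k<n , swapAt-‼-other j xs k≢j k≢j+1 ,
                                transpose-mismatch (k≢j ∘ +-mod-injective r k<n j<n)
                                                   (k≢j+1 ∘ +-mod-injective r k<n j+1<n ∘ flip trans next-i)

  isLift-rotate : ∀ {σ r a xs} → IsLift σ r (a ∷ xs) → IsLift σ (suc r) (xs ++ [ a + n ])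
  isLift-rotate {σ} {r} {a} {xs} lift = record
    { length≡n = trans (length-++ xs) (trans (+-comm (length xs) 1) length≡n)
    ; residue  = residue′
    }
    where
    open IsLift lift
    r+0≋ : r + 0 ≋ suc r + length xs
    r+0≋ = begin
      r + 0               ≡⟨ +-identityʳ r ⟩
      r                   ≈⟨ +n-≋ r ⟨
      r + n               ≡⟨ cong (r +_) length≡n ⟨
      r + suc (length xs) ≡⟨ +-suc r (length xs) ⟩
      suc r + length xs   ∎
      where open ≋-Reasoning
    residue′ : ∀ {k} → k < n → (xs ++ [ a + n ]) ‼ k % n ≡ toℕ (σ ((suc r + k) mod n))
    residue′ {k} k<n with m≤n⇒m<n∨m≡n (s≤s⁻¹ (subst (k <_) (sym length≡n) k<n))
    ... | inj₁ k<l    = trans (cong (_% n) (++-‼-< xs k<l))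
                              (trans (residue (subst (suc k <_) length≡n (s<s k<l))) (cong (λ x → toℕ (σ (x mod n))) (+-suc r k)))
    ... | inj₂ refl   = begin
      (xs ++ [ a + n ]) ‼ length xs % n   ≡⟨ cong (_% n) (++-‼-length xs) ⟩
      (a + n) % n                        ≡⟨ +n-≋ a ⟩
      a % n                              ≡⟨ residue 0<n ⟩
      toℕ (σ ((r + 0) mod n))            ≡⟨ cong (toℕ ∘ σ) (mod-cong r+0≋) ⟩
      toℕ (σ ((suc r + length xs) mod n)) ∎
      where open ≡-Reasoning

  consecutive⇒trivial : ∀ {σ : Labeling n} r c → (∀ {j} → j < n → toℕ (σ ((r + j) mod n)) ≡ (c + j) % n) → IsTrivialCyclic σ
  consecutive⇒trivial {σ} r c consecutive = c + neg r , toℕ-injective ∘ label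
    where
    j : Fin n → ℕ
    j x = (toℕ x + neg r) % n
    position : ∀ x → (r + j x) mod n ≡ x
    position x = trans (mod-cong (begin
      r + j x                ≈⟨ +-congˡ-≋ r (%-≋ _) ⟩
      r + (toℕ x + neg r)    ≡⟨ solve 3 (λ r x m → r :+ (x :+ m) := x :+ (r :+ m)) refl r (toℕ x) (neg r) ⟩
      toℕ x + (r + neg r)    ≈⟨ +-congˡ-≋ (toℕ x) (+-neg-≋ r) ⟩
      toℕ x + 0              ≡⟨ +-identityʳ (toℕ x) ⟩
      toℕ x                  ∎)) (toℕ-mod-inverse x)
      where open ≋-Reasoning
    label : ∀ x → toℕ (σ x) ≡ toℕ ((toℕ x + (c + neg r)) mod n)
    label x = begin
      toℕ (σ x)                        ≡⟨ cong (toℕ ∘ σ) (position x) ⟨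
      toℕ (σ ((r + j x) mod n))        ≡⟨ consecutive (m%n<n _ n) ⟩
      (c + j x) % n                    ≡⟨ +-congˡ-≋ c (%-≋ _) ⟩
      (c + (toℕ x + neg r)) % n        ≡⟨ cong (_% n) (solve 3 (λ c x m → c :+ (x :+ m) := x :+ (c :+ m)) refl c (toℕ x) (neg r)) ⟩
      (toℕ x + (c + neg r)) % n        ≡⟨ toℕ-mod _ ⟨
      toℕ ((toℕ x + (c + neg r)) mod n) ∎
      where open ≡-Reasoning

  increasing⇒trivial : ∀ {σ r xs} → IsLift σ r xs → Injective _≡_ _≡_ σ →
                       (∀ j → suc j < length xs → xs ‼ j ≤ xs ‼ suc j) → xs ‼ pred n ≤ xs ‼ 0 + n →
                       IsTrivialCyclic σ
  increasing⇒trivial {σ} {r} {xs} lift σ-injective increasing last≤ = consecutive⇒trivial r (xs ‼ 0) λ {j} j<n → begin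
    toℕ (σ ((r + j) mod n))   ≡⟨ residue j<n ⟨
    xs ‼ j % n               ≡⟨ cong (_% n) (increasing-pinned (xs ‼_) (pred n) strict last<′ j (<⇒≤pred j<n)) ⟩
    (xs ‼ 0 + j) % n         ∎
    where
    open ≡-Reasoning
    open IsLift lift
    pred-n<n : pred n < n
    pred-n<n = subst (pred n <_) (suc-pred n) (n<1+n (pred n))
    distinct : ∀ {i j} → i < n → j < n → i ≢ j → xs ‼ i ≢ xs ‼ j
    distinct i<n j<n i≢j eq = i≢j (residue-injective lift σ-injective i<n j<n (cong (_% n) eq))
    strict : ∀ j → j < pred n → xs ‼ j < xs ‼ suc j
    strict j j<pred-n = ≤∧≢⇒< (increasing j (subst (suc j <_) (sym length≡n) j+1<n))
                              (distinct (<-trans (n<1+n j) j+1<n) j+1<n (<⇒≢ (n<1+n j)))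
      where
      j+1<n : suc j < n
      j+1<n = subst (suc j <_) (suc-pred n) (s<s j<pred-n)
    last≢ : xs ‼ pred n ≢ xs ‼ 0 + n
    last≢ eq = m≢m+n (xs ‼ 0) (trans (cong (xs ‼_) (sym pred-n≡0)) eq)
      where
      m≢m+n : ∀ m → m ≢ m + n
      m≢m+n m = <⇒≢ (m<m+n m 0<n)
      pred-n≡0 : pred n ≡ 0
      pred-n≡0 = residue-injective lift σ-injective pred-n<n 0<n (trans (cong (_% n) eq) (+n-≋ (xs ‼ 0)))
    last<′ : xs ‼ pred n ≤ xs ‼ 0 + pred n
    last<′ = s≤s⁻¹ (subst (xs ‼ pred n <_) (trans (cong (xs ‼ 0 +_) (sym (suc-pred n))) (+-suc (xs ‼ 0) (pred n)))
                          (≤∧≢⇒< last≤ last≢))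

  Descent : List ℕ → ℕ → Set
  Descent xs j = suc j < length xs × xs ‼ suc j < xs ‼ j

  descent? : ∀ xs → ∃ (Descent xs) ⊎ (∀ j → suc j < length xs → xs ‼ j ≤ xs ‼ suc j)
  descent? []           = inj₂ λ _ ()
  descent? (a ∷ [])     = inj₂ λ { _ (s≤s ()) }
  descent? (a ∷ b ∷ xs) with b <? a | descent? (b ∷ xs)
  ... | yes b<a | _                   = inj₁ (0 , s<s z<s , b<a)
  ... | no  _   | inj₁ (j , j+1<l , d) = inj₁ (suc j , s<s j+1<l , d)
  ... | no  b≮a | inj₂ increasing     = inj₂ λ { zero _ → ≮⇒≥ b≮a ; (suc j) j+1<l → increasing j (s<s⁻¹ j+1<l) }

  SwapStep : Labeling n → ℕ → Set
  SwapStep σ c = ∃ λ i → ∃₂ λ r xs → IsLift (swapAdj i σ) r xs × c ≡ suc (cost xs)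

  swapStep : ∀ {σ r xs j} → IsLift σ r xs → Descent xs j → SwapStep σ (cost xs)
  swapStep {r = r} {xs} {j} lift (j+1<l , d) =
    (r + j) mod n , r , swapAt j xs , isLift-swapAt lift (subst (suc j <_) (IsLift.length≡n lift) j+1<l) , cost-swapAt j xs j+1<l d

  rotateStep : ∀ {σ r xs} → IsLift σ r xs → Injective _≡_ _≡_ σ → xs ‼ 0 + n < xs ‼ pred n → SwapStep σ (cost xs)
  rotateStep {xs = []}         lift _ _ = contradiction (IsLift.length≡n lift) (≢-nonZero⁻¹ n ∘ sym)
  rotateStep {xs = a ∷ []}     lift _ wraps =
    contradiction (subst (λ k → a + n < (a ∷ []) ‼ k) (cong pred (sym (IsLift.length≡n lift))) wraps) (≤⇒≯ (m≤m+n a n))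
  rotateStep {σ} {xs = a ∷ b ∷ xs} lift σ-injective wraps =
    subst (SwapStep σ) (sym (cost-rotate a (b ∷ xs) distinct)) (swapStep (isLift-rotate lift) descent)
    where
    open IsLift lift
    distinct : ∀ k → k < length (b ∷ xs) → a % n ≢ (b ∷ xs) ‼ k % n
    distinct k k<l eq = 0≢1+n (residue-injective lift σ-injective 0<n (subst (suc k <_) length≡n (s<s k<l)) eq)
    descent : Descent ((b ∷ xs) ++ [ a + n ]) (length xs)
    descent = s<s (≤-reflexive (sym (trans (length-++ xs) (+-comm (length xs) 1)))) , (begin-strict
      ((b ∷ xs) ++ [ a + n ]) ‼ suc (length xs)   ≡⟨ ++-‼-length xs ⟩
      a + n                                     <⟨ subst (λ k → a + n < (a ∷ b ∷ xs) ‼ k) (cong pred (sym length≡n)) wraps ⟩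
      (b ∷ xs) ‼ length xs                        ≡⟨ ++-‼-< (b ∷ xs) (n<1+n (length xs)) ⟨
      ((b ∷ xs) ++ [ a + n ]) ‼ length xs         ∎)
      where open ≤-Reasoning

  progress : ∀ {σ r xs} → IsLift σ r xs → Injective _≡_ _≡_ σ → IsTrivialCyclic σ ⊎ SwapStep σ (cost xs)
  progress {xs = xs} lift σ-injective with descent? xs
  ... | inj₁ (j , descent) = inj₂ (swapStep lift descent)
  ... | inj₂ increasing with xs ‼ 0 + n <? xs ‼ pred n
  ...   | yes wraps = inj₂ (rotateStep lift σ-injective wraps)
  ...   | no  fits  = inj₁ (increasing⇒trivial lift σ-injective increasing (≮⇒≥ fits))

  SortableWithin : ℕ → Labeling n → Set
  SortableWithin b σ = ∃₂ λ m τ → SwapPath m σ τ × IsTrivialCyclic τ × m ≤ b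

  sortableWithin-cost : ∀ {σ r xs} → IsLift σ r xs → Injective _≡_ _≡_ σ → SortableWithin (cost xs) σ
  sortableWithin-cost {xs = xs} lift σ-injective = go (cost xs) lift σ-injective refl
    where
    go : ∀ c {σ r xs} → IsLift σ r xs → Injective _≡_ _≡_ σ → cost xs ≡ c → SortableWithin c σ
    go c {σ} lift σ-injective cost≡c with progress lift σ-injective
    ... | inj₁ trivial = 0 , σ , done , trivial , z≤n
    ... | inj₂ (i , _ , xs′ , lift′ , cost≡1+cost′) = extend c (trans (sym cost≡c) cost≡1+cost′)
      where
      extend : ∀ c → c ≡ suc (cost xs′) → SortableWithin c σ
      extend (suc c) c+1≡ with go c lift′ (swapAdj-injective i σ-injective) (sym (suc-injective c+1≡))
      ... | m , τ , path , trivial , m≤c = suc m , τ , step i path , trivial , s≤s m≤c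

module Family {n : ℕ} .{{_ : NonZero n}} (π : Labeling n) (bij : Bijective _≡_ _≡_ π) where
  open Modular n
  open Residues π bij
  open Lifting n

  base : ℕ → ℕ
  base i = P i + (n ∸ i)

  offset : ℕ → ℕ → ℕ
  offset k i = (base i + k) % n

  value : ℕ → ℕ → ℕ
  value k i = (n ∸ k) + i + offset k i

  windowLift : ℕ → List ℕ
  windowLift k = applyUpTo (value k) n

  value-≋ : ∀ {k i} → k ≤ n → i ≤ n → value k i ≋ P i
  value-≋ {k} {i} k≤n i≤n = begin
    (n ∸ k) + i + (P i + (n ∸ i) + k) % n   ≈⟨ +-congˡ-≋ ((n ∸ k) + i) (%-≋ _) ⟩
    (n ∸ k) + i + (P i + (n ∸ i) + k)
      ≡⟨ solve 5 (λ a i p b k → a :+ i :+ (p :+ b :+ k) := p :+ (i :+ b) :+ (a :+ k)) refl (n ∸ k) i (P i) (n ∸ i) k ⟩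
    P i + (i + (n ∸ i)) + ((n ∸ k) + k)     ≡⟨ cong₂ (λ x y → P i + x + y) (m+[n∸m]≡n i≤n) (m∸n+n≡m k≤n) ⟩
    P i + n + n                             ≈⟨ +n-≋ (P i + n) ⟩
    P i + n                                 ≈⟨ +n-≋ (P i) ⟩
    P i                                     ∎
    where open ≋-Reasoning

  isLift-windowLift : ∀ {k} → k ≤ n → IsLift π 0 (windowLift k)
  isLift-windowLift {k} k≤n = record
    { length≡n = length-applyUpTo (value k) n
    ; residue  = λ {j} j<n → trans (cong (_% n) (applyUpTo-‼ (value k) n j<n))
                                   (trans (value-≋ k≤n (<⇒≤ j<n)) (m<n⇒m%n≡m (P<n j)))
    }

  crossings-value : ∀ k {i j} → i ≤ j → crossings (value k i) (value k j) ≡ crossings (offset k i) ((j ∸ i) + offset k j)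
  crossings-value k {i} {j} i≤j = begin
    crossings ((n ∸ k) + i + offset k i) ((n ∸ k) + j + offset k j)
      ≡⟨ cong (λ x → crossings (value k i) ((n ∸ k) + x + offset k j)) (m+[n∸m]≡n i≤j) ⟨
    crossings ((n ∸ k) + i + offset k i) ((n ∸ k) + (i + (j ∸ i)) + offset k j)
      ≡⟨ cong (crossings (value k i))
              (solve 4 (λ a i g o → a :+ (i :+ g) :+ o := a :+ i :+ (g :+ o)) refl (n ∸ k) i (j ∸ i) (offset k j)) ⟩
    crossings ((n ∸ k) + i + offset k i) ((n ∸ k) + i + ((j ∸ i) + offset k j))
      ≡⟨ crossings-+ ((n ∸ k) + i) (offset k i) _ ⟩
    crossings (offset k i) ((j ∸ i) + offset k j) ∎
    where open ≡-Reasoning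

  shift : ℕ → ℕ → ℕ
  shift i j = (base j + neg (base i)) % n

  [∸+shift]%n≡diff : ∀ {i j} → i < j → j < n → ((j ∸ i) + shift i j) % n ≡ diff i j
  [∸+shift]%n≡diff {i} {j} i<j j<n = ≋⇒≡ (m%n<n _ n) (m%n<n _ n) (+-cancelʳ-≋ (base i) (begin
    ((j ∸ i) + shift i j) % n + base i            ≈⟨ +-cong-≋ (%-≋ _) refl ⟩
    (j ∸ i) + shift i j + base i                  ≈⟨ +-cong-≋ (+-congˡ-≋ (j ∸ i) (%-≋ _)) refl ⟩
    (j ∸ i) + (base j + neg (base i)) + base i
      ≡⟨ solve 4 (λ g b m c → g :+ (b :+ m) :+ c := g :+ b :+ (c :+ m)) refl (j ∸ i) (base j) _ (base i) ⟩
    (j ∸ i) + base j + (base i + neg (base i))    ≈⟨ +-congˡ-≋ ((j ∸ i) + base j) (+-neg-≋ (base i)) ⟩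
    (j ∸ i) + base j + 0                          ≡⟨ +-identityʳ _ ⟩
    (j ∸ i) + (P j + (n ∸ j))
      ≡⟨ solve 3 (λ g p m → g :+ (p :+ m) := p :+ (m :+ g)) refl (j ∸ i) (P j) (n ∸ j) ⟩
    P j + ((n ∸ j) + (j ∸ i))                     ≡⟨ cong (P j +_) [n∸j]+[j∸i]≡n∸i ⟩
    P j + (n ∸ i)                                 ≈⟨ +n-≋ _ ⟨
    P j + (n ∸ i) + n                             ≡⟨ cong (P j + (n ∸ i) +_) (m∸n+n≡m (<⇒≤ (P<n i))) ⟨
    P j + (n ∸ i) + ((n ∸ P i) + P i)
      ≡⟨ solve 4 (λ p a b q → p :+ b :+ (q :+ a) := p :+ a :+ (b :+ q)) refl (P j) (n ∸ i) (n ∸ P i) (P i) ⟨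
    P j + (n ∸ P i) + (P i + (n ∸ i))             ≈⟨ +-cong-≋ (%-≋ _) refl ⟨
    diff i j + base i                             ∎))
    where
    open ≋-Reasoning
    [n∸j]+[j∸i]≡n∸i : (n ∸ j) + (j ∸ i) ≡ n ∸ i
    [n∸j]+[j∸i]≡n∸i = trans (sym (+-∸-assoc (n ∸ j) (<⇒≤ i<j))) (cong (_∸ i) (m∸n+n≡m (<⇒≤ j<n)))

  ∑-crossings-values : ∀ {i j} → i < j → j < n → ∑ n (λ k → crossings (value k i) (value k j)) ≡ ∣ diff i j - (j ∸ i) ∣
  ∑-crossings-values {i} {j} i<j j<n = begin
    ∑ n (λ k → crossings (value k i) (value k j))
      ≡⟨ ∑-cong n (λ k _ → trans (crossings-value k (<⇒≤ i<j))
                                 (cong (λ y → crossings (offset k i) (g + y)) (%-shift (base i) (base j) k))) ⟩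
    ∑ n (λ k → F ((base i + k) % n))                   ≡⟨ ∑-rotate n (base i) F ⟩
    ∑ n F                                              ≡⟨ ∑-crossings-cyclic (≤-<-trans (m∸n≤m j i) j<n) (m%n<n _ n) ⟩
    ∣ (g + s) % n - g ∣                                ≡⟨ cong (λ d → ∣ d - g ∣) ([∸+shift]%n≡diff i<j j<n) ⟩
    ∣ diff i j - g ∣                                   ∎
    where
    open ≡-Reasoning
    g = j ∸ i
    s = shift i j
    F : ℕ → ℕ
    F x = crossings x (g + (x + s) % n)

  ∑-cost-windowLift : ∑ n (cost ∘ windowLift) ≡ ∑pairs n (λ i j → ∣ diff i j - (j ∸ i) ∣)
  ∑-cost-windowLift = begin
    ∑ n (cost ∘ windowLift)                                            ≡⟨ ∑-cong n (λ k _ → cost-applyUpTo (value k) n) ⟩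
    ∑ n (λ k → ∑pairs n (λ i j → crossings (value k i) (value k j)))   ≡⟨ ∑-∑pairs-comm n n _ ⟩
    ∑pairs n (λ i j → ∑ n (λ k → crossings (value k i) (value k j)))   ≡⟨ ∑pairs-cong n (λ _ _ → ∑-crossings-values) ⟩
    ∑pairs n (λ i j → ∣ diff i j - (j ∸ i) ∣)                          ∎
    where open ≡-Reasoning

  4*∑-cost-windowLift-≤ : 4 * ∑ n (cost ∘ windowLift) ≤ n * ((n ∸ 1) * (n ∸ 1))
  4*∑-cost-windowLift-≤ = subst (λ x → 4 * x ≤ _) (sym ∑-cost-windowLift) (∑pairs-∣diff-∸∣-≤ π bij)

theorem2p1 : (n : ℕ) .{{_ : NonZero n}} (π : Labeling n) → Bijective _≡_ _≡_ π →
    ∃₂ λ m σ → SwapPath m π σ × IsTrivialCyclic σ × m ≤ ((n ∸ 1) ^ 2) / 4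
theorem2p1 n π bij@(π-injective , _) =
  let open Family π bij
      open Lifting n
      k , k<n , 4*cost≤ = ∃-≤-average n (λ k → 4 * cost (windowLift k)) _
                                      (subst (_≤ _) (*-distribˡ-∑ n 4 _) 4*∑-cost-windowLift-≤)
      m , σ , path , trivial , m≤cost = sortableWithin-cost (isLift-windowLift (<⇒≤ k<n)) π-injective
  in m , σ , path , trivial , m*n≤o⇒m≤o/n m 4 (begin
      m * 4             ≡⟨ *-comm m 4 ⟩
      4 * m             ≤⟨ *-monoʳ-≤ 4 m≤cost ⟩
      4 * cost (windowLift k) ≤⟨ 4*cost≤ ⟩
      (n ∸ 1) * (n ∸ 1) ≡⟨ cong ((n ∸ 1) *_) (*-identityʳ (n ∸ 1)) ⟨
      (n ∸ 1) ^ 2       ∎)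
  where open ≤-Reasoning
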